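{- Let $\alpha=(1+\sqrt5)/2$ and let $A:=\{(2,1)\}\cup\{(1,d): d\in\mathbb N\}$. If $(s,d)\in\mathbb N^2\setminus A$, then \[1+\alpha^{sd}-\alpha^n\sqrt5^{\,s-1}\neq 0\] for every $n\in\mathbb Z$.
   Context: $\mathbb N$ denotes the set of positive integers. -}

module Defs where

open import Data.Nat using (ℕ; zero; suc)
open import Data.Integer using (ℤ; +_; -[1+_]) renaming (_+_ to _+ℤ_; _*_ to _*ℤ_; -_ to -ℤ_)

-- The ring ℤ[α] ⊂ ℝ, α = (1+√5)/2, α² = α + 1.
-- An element  a ⊕ b  denotes the real number a + b·α.  Since 1 and α are
-- linearly independent over ℚ, two such reals are equal iff their
-- coordinates are equal, so propositional equality of ℤ[α] is real equality.
record ℤ[α] : Set where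
  constructor _⊕_
  field
    re : ℤ
    im : ℤ

infixl 6 _+_ _-_
infixl 7 _*_
infixr 8 _^_

_+_ : ℤ[α] → ℤ[α] → ℤ[α]
(a ⊕ b) + (c ⊕ d) = (a +ℤ c) ⊕ (b +ℤ d)

-_ : ℤ[α] → ℤ[α]
- (a ⊕ b) = (-ℤ a) ⊕ (-ℤ b)

_-_ : ℤ[α] → ℤ[α] → ℤ[α]
x - y = x + (- y)

-- (a + bα)(c + dα) = (ac + bd) + (ad + bc + bd)α   using α² = α + 1
_*_ : ℤ[α] → ℤ[α] → ℤ[α]
(a ⊕ b) * (c ⊕ d) = (a *ℤ c +ℤ b *ℤ d) ⊕ (a *ℤ d +ℤ b *ℤ c +ℤ b *ℤ d)

0α 1α : ℤ[α]
0α = (+ 0) ⊕ (+ 0)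
1α = (+ 1) ⊕ (+ 0)

α : ℤ[α]
α = (+ 0) ⊕ (+ 1)

-- α⁻¹ = α - 1  (since α(α - 1) = α² - α = 1)
α⁻¹ : ℤ[α]
α⁻¹ = -[1+ 0 ] ⊕ (+ 1)

√5 : ℤ[α]
√5 = -[1+ 0 ] ⊕ (+ 2)

_^_ : ℤ[α] → ℕ → ℤ[α]
x ^ zero = 1α
x ^ suc n = x * (x ^ n)

α^ : ℤ → ℤ[α]
α^ (+ n) = α ^ n
α^ -[1+ n ] = α⁻¹ ^ suc n

{-# OPTIONS --safe #-}
module Submission where

-- The norm N(a + bα) = a² + ab − b² of ℤ[α] is multiplicative, with |N α| = |N α⁻¹| = 1 and
-- |N √5| = 5, so the right-hand side α^n √5^(s−1) has |N| = 5^(s−1).  On the left,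
-- N(1 + x) = Tr x + 1 + N x, and for x = α^m the trace is the Lucas number L_m while
-- N x = ±1; hence |N(1 + α^m)| ∈ {L_m, L_m + 2}.  It remains to see that 5^(s−1) is never
-- within [L_(sd), L_(sd) + 2].  Since L_(n+4) ≥ 5 L_n for n ≥ 1, the power lies below
-- L_(4s) ≤ L_(sd) when d ≥ 4; since L_(n+3) + 2 ≤ 5 L_n for n ≥ 2, it lies above
-- L_(3s) + 2 ≥ L_(sd) + 2 when d ≤ 3 and s ≥ 10.  The remaining pairs are checked by
-- computation; only (s, d) = (2, 1) fails, as L_2 + 2 = 5.

module Lucas where

  open import Data.Nat
  open import Data.Nat.Properties
  open import Data.Nat.Tactic.RingSolver using (solve-∀)
  open import Data.Product using (_×_; _,_)
  open import Data.Sum using (_⊎_; inj₁; inj₂)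
  open import Data.Unit using (tt)
  open import Data.List using (applyUpTo)
  open import Data.List.Relation.Unary.All using (All; all?)
  open import Data.List.Relation.Unary.All.Properties using (applyUpTo⁻)
  open import Relation.Nullary using (¬_; Dec; yes; no; ¬?; _×-dec_; _⊎-dec_; _→-dec_)
  open import Relation.Nullary.Decidable using (from-yes)
  open import Relation.Binary.PropositionalEquality using (_≡_; sym; cong)

  lucas : ℕ → ℕ
  lucas 0 = 2
  lucas 1 = 1
  lucas (suc (suc n)) = lucas (suc n) + lucas n

  lucas-positive : ∀ n → 1 ≤ lucas n
  lucas-positive 0 = s≤s z≤n
  lucas-positive 1 = s≤s z≤n
  lucas-positive (suc (suc n)) = ≤-trans (lucas-positive (suc n)) (m≤m+n _ _)

  lucas-mono : ∀ {m n} → 1 ≤ m → m ≤ n → lucas m ≤ lucas n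
  lucas-mono (s≤s z≤n) (s≤s m≤n) = from-suc (≤⇒≤′ m≤n)
    where
    from-suc : ∀ {m n} → m ≤′ n → lucas (suc m) ≤ lucas (suc n)
    from-suc ≤′-refl = ≤-refl
    from-suc (≤′-step m≤′n) = ≤-trans (from-suc m≤′n) (m≤m+n _ _)

  lucas[5+n] : ∀ n → lucas (5 + n) ≡ 5 * lucas (1 + n) + 3 * lucas n
  lucas[5+n] n = unfolded (lucas (1 + n)) (lucas n)
    where
    unfolded : ∀ a b → a + b + a + (a + b) + (a + b + a) ≡ 5 * a + 3 * b
    unfolded = solve-∀

  5*lucas[1+n]≤lucas[5+n] : ∀ n → 5 * lucas (1 + n) ≤ lucas (5 + n)
  5*lucas[1+n]≤lucas[5+n] n = ≤-trans (m≤m+n _ _) (≤-reflexive (sym (lucas[5+n] n)))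

  lucas[5+n]+2≤5*lucas[2+n] : ∀ n → lucas (5 + n) + 2 ≤ 5 * lucas (2 + n)
  lucas[5+n]+2≤5*lucas[2+n] n = begin
    lucas (5 + n) + 2       ≡⟨ cong (_+ 2) (lucas[5+n] n) ⟩
    5 * a + 3 * b + 2       ≤⟨ +-monoʳ-≤ (5 * a + 3 * b) (*-monoʳ-≤ 2 (lucas-positive n)) ⟩
    5 * a + 3 * b + 2 * b   ≡⟨ regroup a b ⟩
    5 * lucas (2 + n)       ∎
    where
    open ≤-Reasoning
    a = lucas (1 + n)
    b = lucas n
    regroup : ∀ a b → 5 * a + 3 * b + 2 * b ≡ 5 * (a + b)
    regroup = solve-∀

  5^j<lucas[4j+4] : ∀ j → 5 ^ j < lucas (suc j * 4)
  5^j<lucas[4j+4] zero = <ᵇ⇒< 1 7 tt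
  5^j<lucas[4j+4] (suc j) = begin-strict
    5 * 5 ^ j               <⟨ *-monoʳ-< 5 (5^j<lucas[4j+4] j) ⟩
    5 * lucas (suc j * 4)   ≤⟨ 5*lucas[1+n]≤lucas[5+n] (3 + j * 4) ⟩
    lucas (suc (suc j) * 4) ∎
    where open ≤-Reasoning

  lucas[3j+3]+2<5^j : ∀ {j} → 9 ≤ j → lucas (suc j * 3) + 2 < 5 ^ j
  lucas[3j+3]+2<5^j 9≤j = from-9 (≤⇒≤′ 9≤j)
    where
    open ≤-Reasoning
    from-9 : ∀ {j} → 9 ≤′ j → lucas (suc j * 3) + 2 < 5 ^ j
    from-9 ≤′-refl = <ᵇ⇒< (lucas 30 + 2) (5 ^ 9) tt
    from-9 (≤′-step {j} 9≤′j) = begin-strict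
      lucas (suc (suc j) * 3) + 2 ≤⟨ lucas[5+n]+2≤5*lucas[2+n] (1 + j * 3) ⟩
      5 * lucas (suc j * 3)       <⟨ *-monoʳ-< 5 (≤-<-trans (m≤m+n _ 2) (from-9 9≤′j)) ⟩
      5 * 5 ^ j                   ∎

  infix 4 _∈[_,_] _∉[_,_]

  _∈[_,_] _∉[_,_] : ℕ → ℕ → ℕ → Set
  k ∈[ a , b ] = a ≤ k × k ≤ b
  k ∉[ a , b ] = k < a ⊎ b < k

  ∉[,]⇒¬∈[,] : ∀ {k a b} → k ∉[ a , b ] → ¬ k ∈[ a , b ]
  ∉[,]⇒¬∈[,] (inj₁ k<a) (a≤k , _) = <⇒≱ k<a a≤k
  ∉[,]⇒¬∈[,] (inj₂ b<k) (_ , k≤b) = <⇒≱ b<k k≤b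

  LucasAvoids5^ : ℕ → ℕ → Set
  LucasAvoids5^ s d = ¬ (s ≡ 2 × d ≡ 1) → 5 ^ (s ∸ 1) ∉[ lucas (s * d) , lucas (s * d) + 2 ]

  lucasAvoids5^? : ∀ s d → Dec (LucasAvoids5^ s d)
  lucasAvoids5^? s d =
    ¬? (s ≟ 2 ×-dec d ≟ 1) →-dec
    (5 ^ (s ∸ 1) <? lucas (s * d) ⊎-dec lucas (s * d) + 2 <? 5 ^ (s ∸ 1))

  lucasAvoids5^-small : ∀ {s d} → 2 ≤ s → s ≤ 9 → 1 ≤ d → d ≤ 3 → LucasAvoids5^ s d
  lucasAvoids5^-small {suc zero} (s≤s ())
  lucasAvoids5^-small {suc (suc _)} {suc _} _ s≤9 _ d≤3 =
    applyUpTo⁻ suc 3 (applyUpTo⁻ (2 +_) 8 checked (≤-pred s≤9)) d≤3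
    where
    checked : All (λ s → All (LucasAvoids5^ s) (applyUpTo suc 3)) (applyUpTo (2 +_) 8)
    checked = from-yes (all? (λ s → all? (lucasAvoids5^? s) (applyUpTo suc 3)) (applyUpTo (2 +_) 8))

  lucasAvoids5^ : ∀ {s d} → 2 ≤ s → 1 ≤ d → LucasAvoids5^ s d
  lucasAvoids5^ {s@(suc j)} {d} 2≤s 1≤d with 4 ≤? d | 10 ≤? s
  ... | yes 4≤d | _ = λ _ → inj₁ (begin-strict
    5 ^ j             <⟨ 5^j<lucas[4j+4] j ⟩
    lucas (s * 4)     ≤⟨ lucas-mono (s≤s z≤n) (*-monoʳ-≤ s 4≤d) ⟩
    lucas (s * d)     ∎)
    where open ≤-Reasoning
  ... | no 4≰d | yes 10≤s = λ _ → inj₂ (begin-strict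
    lucas (s * d) + 2 ≤⟨ +-monoˡ-≤ 2 (lucas-mono (≤-trans 1≤d (m≤m+n d _)) (*-monoʳ-≤ s d≤3)) ⟩
    lucas (s * 3) + 2 <⟨ lucas[3j+3]+2<5^j (≤-pred 10≤s) ⟩
    5 ^ j             ∎)
    where
    open ≤-Reasoning
    d≤3 = ≤-pred (≰⇒> 4≰d)
  ... | no 4≰d | no 10≰s = lucasAvoids5^-small 2≤s (≤-pred (≰⇒> 10≰s)) 1≤d (≤-pred (≰⇒> 4≰d))

-- The ring solver does not unfold `norm`, `trace` or the ℤ[α] operations, so these identities
-- are stated on coordinates, in the shape those definitions compute to.
module IntegerIdentities where

  open import Data.Integer using (ℤ; _+_; _*_; _-_; 0ℤ; 1ℤ)
  open import Relation.Binary.PropositionalEquality using (_≡_)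
  open import Data.Integer.Tactic.RingSolver using (solve-∀)

  norm-form-* : ∀ a b c d → let p = a * c + b * d ; q = a * d + b * c + b * d in
                p * p + p * q - q * q ≡ (a * a + a * b - b * b) * (c * c + c * d - d * d)
  norm-form-* = solve-∀

  norm-form-1+ : ∀ a b → (1ℤ + a) * (1ℤ + a) + (1ℤ + a) * (0ℤ + b) - (0ℤ + b) * (0ℤ + b)
                         ≡ (a + a + b) + (1ℤ + (a * a + a * b - b * b))
  norm-form-1+ = solve-∀

  α-shift-re : ∀ a b → 0ℤ * a + 1ℤ * b ≡ b
  α-shift-re = solve-∀

  α-shift-im : ∀ a b → 0ℤ * b + 1ℤ * a + 1ℤ * b ≡ a + b
  α-shift-im = solve-∀

  trace-form-recurrence : ∀ a b → (a + b) + (a + b) + (b + (a + b)) ≡ (b + b + (a + b)) + (a + a + b)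
  trace-form-recurrence = solve-∀

open import Defs
open import Data.Nat using (ℕ; _≤_; _∸_) renaming (_*_ to _*ℕ_)
open import Data.Integer using (ℤ)
open import Data.Product using (_×_)
open import Relation.Nullary using (¬_)
open import Relation.Binary.PropositionalEquality using (_≡_; _≢_)

import Data.Nat as ℕ
import Data.Nat.Properties as ℕP
import Data.Integer as ℤ
import Data.Integer.Properties as ℤP
open import Data.Integer using (+_; -[1+_]; ∣_∣; 1ℤ)
open import Data.Product using (_,_)
open import Function using (_∘_)
open import Relation.Binary.PropositionalEquality
  using (refl; sym; trans; cong; cong₂; subst; module ≡-Reasoning)
open Lucas using (lucas; _∈[_,_]; ∉[,]⇒¬∈[,]; lucasAvoids5^)
open IntegerIdentities

-- The field norm and trace of ℚ(√5)/ℚ: a + bα times, resp. plus, its conjugate a + b(1 − α).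
norm : ℤ[α] → ℤ
norm (a ⊕ b) = a ℤ.* a ℤ.+ a ℤ.* b ℤ.- b ℤ.* b

trace : ℤ[α] → ℤ
trace (a ⊕ b) = a ℤ.+ a ℤ.+ b

norm-* : ∀ x y → norm (x * y) ≡ norm x ℤ.* norm y
norm-* (a ⊕ b) (c ⊕ d) = norm-form-* a b c d

norm-1+ : ∀ x → norm (1α + x) ≡ trace x ℤ.+ (1ℤ ℤ.+ norm x)
norm-1+ (a ⊕ b) = norm-form-1+ a b

∣norm∣-* : ∀ x y → ∣ norm (x * y) ∣ ≡ ∣ norm x ∣ ℕ.* ∣ norm y ∣
∣norm∣-* x y = trans (cong ∣_∣ (norm-* x y)) (ℤP.abs-* (norm x) (norm y))

∣norm∣-^ : ∀ x m → ∣ norm (x ^ m) ∣ ≡ ∣ norm x ∣ ℕ.^ m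
∣norm∣-^ x ℕ.zero = refl
∣norm∣-^ x (ℕ.suc m) = trans (∣norm∣-* x (x ^ m)) (cong (∣ norm x ∣ ℕ.*_) (∣norm∣-^ x m))

∣norm∣-α^ : ∀ n → ∣ norm (α^ n) ∣ ≡ 1
∣norm∣-α^ (+ m) = trans (∣norm∣-^ α m) (ℕP.^-zeroˡ m)
∣norm∣-α^ -[1+ m ] = trans (∣norm∣-^ α⁻¹ (ℕ.suc m)) (ℕP.^-zeroˡ (ℕ.suc m))

∣norm∣-α^*√5^ : ∀ n j → ∣ norm (α^ n * √5 ^ j) ∣ ≡ 5 ℕ.^ j
∣norm∣-α^*√5^ n j = begin
  ∣ norm (α^ n * √5 ^ j) ∣               ≡⟨ ∣norm∣-* (α^ n) (√5 ^ j) ⟩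
  ∣ norm (α^ n) ∣ ℕ.* ∣ norm (√5 ^ j) ∣ ≡⟨ cong₂ ℕ._*_ (∣norm∣-α^ n) (∣norm∣-^ √5 j) ⟩
  1 ℕ.* 5 ℕ.^ j                         ≡⟨ ℕP.*-identityˡ (5 ℕ.^ j) ⟩
  5 ℕ.^ j                               ∎
  where open ≡-Reasoning

α-*-⊕ : ∀ a b → α * (a ⊕ b) ≡ b ⊕ (a ℤ.+ b)
α-*-⊕ a b = cong₂ _⊕_ (α-shift-re a b) (α-shift-im a b)

trace-α*α* : ∀ x → trace (α * (α * x)) ≡ trace (α * x) ℤ.+ trace x
trace-α*α* (a ⊕ b) = begin
  trace (α * (α * (a ⊕ b)))               ≡⟨ cong (trace ∘ (α *_)) (α-*-⊕ a b) ⟩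
  trace (α * (b ⊕ (a ℤ.+ b)))             ≡⟨ cong trace (α-*-⊕ b (a ℤ.+ b)) ⟩
  trace ((a ℤ.+ b) ⊕ (b ℤ.+ (a ℤ.+ b)))   ≡⟨ trace-form-recurrence a b ⟩
  trace (b ⊕ (a ℤ.+ b)) ℤ.+ trace (a ⊕ b) ≡⟨ cong (λ y → trace y ℤ.+ trace (a ⊕ b)) (sym (α-*-⊕ a b)) ⟩
  trace (α * (a ⊕ b)) ℤ.+ trace (a ⊕ b)   ∎
  where open ≡-Reasoning

trace-α^ : ∀ m → trace (α ^ m) ≡ + lucas m
trace-α^ 0 = refl
trace-α^ 1 = refl
trace-α^ (ℕ.suc (ℕ.suc m)) = begin
  trace (α * (α * α ^ m))               ≡⟨ trace-α*α* (α ^ m) ⟩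
  trace (α ^ ℕ.suc m) ℤ.+ trace (α ^ m) ≡⟨ cong₂ ℤ._+_ (trace-α^ (ℕ.suc m)) (trace-α^ m) ⟩
  + lucas (ℕ.suc (ℕ.suc m))             ∎
  where open ≡-Reasoning

∣n+[1+u]∣∈[n,n+2] : ∀ n {u} → ∣ u ∣ ≡ 1 → ∣ + n ℤ.+ (1ℤ ℤ.+ u) ∣ ∈[ n , n ℕ.+ 2 ]
∣n+[1+u]∣∈[n,n+2] n {+ _} refl = ℕP.m≤m+n n 2 , ℕP.≤-refl
∣n+[1+u]∣∈[n,n+2] n { -[1+ _ ]} refl = ℕP.m≤m+n n 0 , ℕP.+-monoʳ-≤ n ℕ.z≤n

∣norm∣-1+α^ : ∀ m → ∣ norm (1α + α ^ m) ∣ ∈[ lucas m , lucas m ℕ.+ 2 ]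
∣norm∣-1+α^ m = subst (_∈[ lucas m , lucas m ℕ.+ 2 ]) (sym ∣norm∣≡)
  (∣n+[1+u]∣∈[n,n+2] (lucas m) {norm (α ^ m)} (∣norm∣-α^ (+ m)))
  where
  ∣norm∣≡ : ∣ norm (1α + α ^ m) ∣ ≡ ∣ + lucas m ℤ.+ (1ℤ ℤ.+ norm (α ^ m)) ∣
  ∣norm∣≡ = cong ∣_∣ (trans (norm-1+ (α ^ m)) (cong (ℤ._+ (1ℤ ℤ.+ norm (α ^ m))) (trace-α^ m)))

x-y≡0α⇒x≡y : ∀ x y → x - y ≡ 0α → x ≡ y
x-y≡0α⇒x≡y (a ⊕ b) (c ⊕ d) eq =
  cong₂ _⊕_ (ℤP.i-j≡0⇒i≡j a c (cong ℤ[α].re eq)) (ℤP.i-j≡0⇒i≡j b d (cong ℤ[α].im eq))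

lemma4p1 : (s d : ℕ) → 1 ≤ s → 1 ≤ d → s ≢ 1 → ¬ (s ≡ 2 × d ≡ 1) →
           (n : ℤ) → 1α + α ^ (s *ℕ d) - α^ n * √5 ^ (s ∸ 1) ≢ 0α
lemma4p1 s d 1≤s 1≤d s≢1 not-2-1 n difference≡0 =
  ∉[,]⇒¬∈[,] (lucasAvoids5^ (ℕP.≤∧≢⇒< 1≤s (s≢1 ∘ sym)) 1≤d not-2-1)
    (subst (_∈[ lucas m , lucas m ℕ.+ 2 ]) ∣norm∣≡5^[s∸1] (∣norm∣-1+α^ m))
  where
  m = s *ℕ d
  ∣norm∣≡5^[s∸1] : ∣ norm (1α + α ^ m) ∣ ≡ 5 ℕ.^ (s ∸ 1)
  ∣norm∣≡5^[s∸1] =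
    trans (cong (∣_∣ ∘ norm) (x-y≡0α⇒x≡y (1α + α ^ m) (α^ n * √5 ^ (s ∸ 1)) difference≡0))
          (∣norm∣-α^*√5^ n (s ∸ 1))
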